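{- Let $K$ be a complete discretely valued field with ring of integers $\mathcal{O}_K$ and uniformiser $\pi$, let $G$ be a group and $\rho\colon G\to\mathrm{GL}_2(K)$ a representation. Fix $x\in\mathcal{X}(\rho)$ with representative lattice $\Lambda_x$, and an integer $r\ge1$. Then $G$ acts on $\Lambda_x/\pi^r\Lambda_x$ by a one-dimensional character (i.e.\ there is a character $\chi\colon G\to(\mathcal{O}_K/\pi^r\mathcal{O}_K)^\times$ with $\rho(g)$ acting as multiplication by $\chi(g)$ on $\Lambda_x/\pi^r\Lambda_x$ for all $g$) if and only if $B(x,r)\subseteq\mathcal{X}(\rho)$.
   Context: A lattice is a free rank-$2$ $\mathcal{O}_K$-submodule of $K^2$ spanning $K^2$. The Bruhat--Tits tree $\mathcal{X}$ has vertices the homothety classes of lattices, two classes being adjacent if they have representatives with $\pi\Lambda_x\subsetneq\Lambda_y\subsetneq\Lambda_x$; $d$ is the graph distance. $\mathcal{X}(\rho)$ is the set of vertices whose representatives are stable under $\rho(g)$ for all $g\in G$. $B(x,r)$ is the set of vertices of $\mathcal{X}$ at distance at most $r$ from $x$. -}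

module Defs where

open import Level using (Level; _⊔_) renaming (suc to lsuc)
open import Data.Nat using (ℕ; zero; suc; _≥_)
open import Data.Integer as ℤ using (ℤ)
open import Data.Product using (Σ; _×_; _,_; ∃)
open import Relation.Nullary using (¬_)
open import Relation.Binary.PropositionalEquality using (_≡_)
open import Function.Bundles using (_⇔_)
open import Algebra.Bundles using (CommutativeRing; Group)

data ℤ∞ : Set where
  fin : ℤ → ℤ∞
  ∞   : ℤ∞

infix 4 _≤∞_
data _≤∞_ : ℤ∞ → ℤ∞ → Set where
  fin≤fin : ∀ {m n} → m ℤ.≤ n → fin m ≤∞ fin n
  _≤∞∞    : ∀ x → x ≤∞ ∞

_+∞_ : ℤ∞ → ℤ∞ → ℤ∞
fin m +∞ fin n = fin (m ℤ.+ n)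
fin _ +∞ ∞     = ∞
∞     +∞ _     = ∞

min∞ : ℤ∞ → ℤ∞ → ℤ∞
min∞ (fin m) (fin n) = fin (m ℤ.⊓ n)
min∞ (fin m) ∞       = fin m
min∞ ∞       y       = y

record CompleteDVF (c ℓ : Level) : Set (lsuc (c ⊔ ℓ)) where
  field
    commRing : CommutativeRing c ℓ
  open CommutativeRing commRing public
  field
    1≉0     : ¬ (1# ≈ 0#)
    inverse : ∀ x → ¬ (x ≈ 0#) → Σ Carrier (λ y → x * y ≈ 1#)
    v       : Carrier → ℤ∞
    v-cong  : ∀ {x y} → x ≈ y → v x ≡ v y
    v-∞     : ∀ x → (v x ≡ ∞) ⇔ (x ≈ 0#)
    v-mult  : ∀ x y → v (x * y) ≡ v x +∞ v y
    v-ultra : ∀ x y → min∞ (v x) (v y) ≤∞ v (x + y)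
    π       : Carrier
    v-π     : v π ≡ fin (ℤ.+ 1)
    complete : (a : ℕ → Carrier) →
               (∀ (n : ℤ) → Σ ℕ (λ N → ∀ m k → m ≥ N → k ≥ N → fin n ≤∞ v (a m - a k))) →
               Σ Carrier (λ L → ∀ (n : ℤ) → Σ ℕ (λ N → ∀ m → m ≥ N → fin n ≤∞ v (a m - L)))

  InO : Carrier → Set
  InO x = fin (ℤ.+ 0) ≤∞ v x

  _^_ : Carrier → ℕ → Carrier
  x ^ zero  = 1#
  x ^ suc n = x * (x ^ n)

module LinAlg {c ℓ : Level} (K : CompleteDVF c ℓ) where
  open CompleteDVF K

  V : Set c
  V = Carrier × Carrier

  _≈V_ : V → V → Set ℓ
  (x₁ , x₂) ≈V (y₁ , y₂) = (x₁ ≈ y₁) × (x₂ ≈ y₂)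

  _+V_ : V → V → V
  (x₁ , x₂) +V (y₁ , y₂) = (x₁ + y₁ , x₂ + y₂)

  _-V_ : V → V → V
  (x₁ , x₂) -V (y₁ , y₂) = (x₁ - y₁ , x₂ - y₂)

  _•_ : Carrier → V → V
  a • (x₁ , x₂) = (a * x₁ , a * x₂)

  0V : V
  0V = (0# , 0#)

  record Mat : Set c where
    constructor mat
    field
      m₁₁ m₁₂ m₂₁ m₂₂ : Carrier

  _≈M_ : Mat → Mat → Set ℓ
  mat a b c' d ≈M mat a' b' c'' d' = (a ≈ a') × (b ≈ b') × (c' ≈ c'') × (d ≈ d')

  _*M_ : Mat → Mat → Mat
  mat a b c' d *M mat a' b' c'' d' =
    mat (a * a' + b * c'') (a * b' + b * d') (c' * a' + d * c'') (c' * b' + d * d')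

  IM : Mat
  IM = mat 1# 0# 0# 1#

  _·_ : Mat → V → V
  mat a b c' d · (x₁ , x₂) = (a * x₁ + b * x₂ , c' * x₁ + d * x₂)

module Tree {c ℓ g ℓg : Level} (K : CompleteDVF c ℓ) (G : Group g ℓg) where
  open CompleteDVF K
  open LinAlg K
  module G = Group G

  record Rep : Set (c ⊔ ℓ ⊔ g ⊔ ℓg) where
    field
      ρ          : G.Carrier → Mat
      ρ-cong     : ∀ {h h'} → h G.≈ h' → ρ h ≈M ρ h'
      ρ-hom      : ∀ h h' → ρ (h G.∙ h') ≈M (ρ h *M ρ h')
      ρ-ε        : ρ G.ε ≈M IM
      ρ-invertible : ∀ h → Σ Mat (λ N → ((ρ h *M N) ≈M IM) × ((N *M ρ h) ≈M IM))

  -- a lattice: a free rank-2 𝒪_K-submodule of K² spanning K²,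
  -- given by an 𝒪_K-basis b₁ , b₂
  record Lattice : Set (c ⊔ ℓ) where
    field
      b₁ b₂ : V
      free  : ∀ a b → InO a → InO b → ((a • b₁) +V (b • b₂)) ≈V 0V → (a ≈ 0#) × (b ≈ 0#)
      spans : ∀ w → Σ Carrier (λ a → Σ Carrier (λ b → w ≈V ((a • b₁) +V (b • b₂))))

  _∈L_ : V → Lattice → Set (c ⊔ ℓ)
  w ∈L Λ = Σ Carrier (λ a → Σ Carrier (λ b →
             InO a × InO b × (w ≈V ((a • Lattice.b₁ Λ) +V (b • Lattice.b₂ Λ)))))

  _∈[_]L_ : V → Carrier → Lattice → Set (c ⊔ ℓ)
  w ∈[ t ]L Λ = Σ V (λ u → (u ∈L Λ) × (w ≈V (t • u)))

  _⊆L_ : Lattice → Lattice → Set (c ⊔ ℓ)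
  Λ ⊆L Λ' = ∀ w → w ∈L Λ → w ∈L Λ'

  -- homothety of lattices (same vertex of the tree)
  Homothetic : Lattice → Lattice → Set (c ⊔ ℓ)
  Homothetic Λ Λ' = Σ Carrier (λ t → ¬ (t ≈ 0#) × (∀ w → (w ∈L Λ') ⇔ (w ∈[ t ]L Λ)))

  StrictChain : Lattice → Lattice → Set (c ⊔ ℓ)
  StrictChain Λx Λy =
    (∀ w → w ∈[ π ]L Λx → w ∈L Λy) × Σ V (λ w → (w ∈L Λy) × ¬ (w ∈[ π ]L Λx)) ×
    (Λy ⊆L Λx) × Σ V (λ w → (w ∈L Λx) × ¬ (w ∈L Λy))

  Adjacent : Lattice → Lattice → Set (c ⊔ ℓ)
  Adjacent Λ Λ' = Σ Lattice (λ Λx → Σ Lattice (λ Λy →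
                    Homothetic Λ Λx × Homothetic Λ' Λy × StrictChain Λx Λy))

  -- Within n x y  ⇔  d(x , y) ≤ n  (a path of length ≤ n in the tree)
  data Within : ℕ → Lattice → Lattice → Set (c ⊔ ℓ) where
    here : ∀ {n x y} → Homothetic x y → Within n x y
    step : ∀ {n x z y} → Adjacent x z → Within n z y → Within (suc n) x y

  _∈B[_,_] : Lattice → Lattice → ℕ → Set (c ⊔ ℓ)
  y ∈B[ x , r ] = Within r x y

  module _ (R : Rep) where
    open Rep R

    InX : Lattice → Set (c ⊔ ℓ ⊔ g)
    InX Λ = ∀ h w → w ∈L Λ → (ρ h · w) ∈L Λ

    CongMod : ℕ → Carrier → Carrier → Set (c ⊔ ℓ)
    CongMod r a b = Σ Carrier (λ t → InO t × ((a - b) ≈ ((π ^ r) * t)))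

    -- G acts on Λ/π^r Λ through a character χ : G → (𝒪_K/π^r 𝒪_K)^×
    -- (χ given by a choice of lifts χ h ∈ 𝒪_K)
    ActsByCharacter : Lattice → ℕ → Set (c ⊔ ℓ ⊔ g ⊔ ℓg)
    ActsByCharacter Λ r = Σ (G.Carrier → Carrier) (λ χ →
        (∀ h → InO (χ h)) ×
        (∀ h h' → h G.≈ h' → CongMod r (χ h) (χ h')) ×
        (∀ h h' → CongMod r (χ (h G.∙ h')) (χ h * χ h')) ×
        (∀ h → Σ Carrier (λ u → InO u × CongMod r (χ h * u) 1#)) ×
        (∀ h w → w ∈L Λ → ((ρ h · w) -V (χ h • w)) ∈[ π ^ r ]L Λ))

{-# OPTIONS --safe #-}
-- Say that ρ acts on Λ through χ modulo πᵐ if ρ(h) w ≡ χ(h) w mod πᵐ Λ for all w ∈ Λ.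
-- This is invariant under homothety, and passes from Λ to a neighbour Λ' (πΛ ⊊ Λ' ⊊ Λ)
-- with m lowered by one; along a path of length ≤ r the condition modulo πʳ at x thus
-- becomes the condition modulo 1 at y, which is stability of y.
-- Conversely, for a basis e₁, e₂ of Λ the lattices ⟨e₁, πʳe₂⟩, ⟨e₂, πʳe₁⟩ and
-- ⟨e₁ + e₂, πʳe₂⟩ lie at distance r from Λ.  Their stability makes e₁, e₂ and e₁ + e₂
-- eigenvectors of every ρ(h) modulo πʳΛ, so the three eigenvalues agree modulo πʳ and
-- ρ(h) acts as a scalar χ(h).  Comparing coefficients of ρ(h h') e₁ = ρ(h) ρ(h') e₁
-- shows that χ is a character modulo πʳ.
module Submission where

open import Defs
open import Level using (Level; _⊔_)
open import Data.Nat using (ℕ; _≥_)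
open import Function.Bundles using (_⇔_)
open import Algebra.Bundles using (Group)

open import Data.Nat as ℕ using (zero; suc; z≤n)
import Data.Nat.Properties as ℕ
open import Data.Integer as ℤ using (+_; 0ℤ; +≤+)
import Data.Integer.Properties as ℤ
open import Data.Product using (Σ; _×_; _,_; proj₁; proj₂)
open import Data.Product.Relation.Binary.Pointwise.NonDependent using (×-setoid)
open import Data.Empty using (⊥-elim)
open import Relation.Nullary using (¬_)
open import Relation.Binary.Bundles using (Setoid)
import Relation.Binary.Reasoning.Setoid
open import Relation.Binary.PropositionalEquality as ≡ using (_≡_)
open import Function.Bundles using (Equivalence; mk⇔)

module ValuationRing {c ℓ : Level} (K : CompleteDVF c ℓ) where
  open CompleteDVF K
  open import Algebra.Properties.Ring ring using (-1*x≈-x; -‿involutive)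
  open import Algebra.Properties.Ring ℤ.+-*-ring using (x+x≈x⇒x≈0)

  fin-injective : ∀ {m n} → fin m ≡ fin n → m ≡ n
  fin-injective ≡.refl = ≡.refl

  v-1# : v 1# ≡ fin 0ℤ
  v-1# with v 1# in eq
  ... | ∞     = ⊥-elim (1≉0 (Equivalence.to (v-∞ 1#) eq))
  ... | fin n = ≡.cong fin (x+x≈x⇒x≈0 n (fin-injective (begin
    fin (n ℤ.+ n)  ≡⟨ ≡.cong₂ _+∞_ eq eq ⟨
    v 1# +∞ v 1#   ≡⟨ v-mult 1# 1# ⟨
    v (1# * 1#)    ≡⟨ v-cong (*-identityˡ 1#) ⟩
    v 1#           ≡⟨ eq ⟩
    fin n          ∎)))
    where open ≡.≡-Reasoning

  v-π^ : ∀ k → v (π ^ k) ≡ fin (+ k)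
  v-π^ zero    = v-1#
  v-π^ (suc k) = ≡.trans (v-mult π (π ^ k)) (≡.cong₂ _+∞_ v-π (v-π^ k))

  π^≉0 : ∀ k → ¬ (π ^ k ≈ 0#)
  π^≉0 k π^k≈0 with ≡.trans (≡.sym (v-π^ k)) (Equivalence.from (v-∞ _) π^k≈0)
  ... | ()

  ≤∞-trans : ∀ {a b d} → a ≤∞ b → b ≤∞ d → a ≤∞ d
  ≤∞-trans (fin≤fin p) (fin≤fin q) = fin≤fin (ℤ.≤-trans p q)
  ≤∞-trans _           (_ ≤∞∞)     = _ ≤∞∞

  0≤∞-+∞ : ∀ {a b} → fin 0ℤ ≤∞ a → fin 0ℤ ≤∞ b → fin 0ℤ ≤∞ a +∞ b
  0≤∞-+∞ (fin≤fin (+≤+ _)) (fin≤fin (+≤+ _)) = fin≤fin (+≤+ z≤n)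
  0≤∞-+∞ (fin≤fin _)       (_ ≤∞∞)           = _ ≤∞∞
  0≤∞-+∞ (_ ≤∞∞)           _                 = _ ≤∞∞

  0≤∞-min∞ : ∀ {a b} → fin 0ℤ ≤∞ a → fin 0ℤ ≤∞ b → fin 0ℤ ≤∞ min∞ a b
  0≤∞-min∞ (fin≤fin (+≤+ _)) (fin≤fin (+≤+ _)) = fin≤fin (+≤+ z≤n)
  0≤∞-min∞ (fin≤fin p)       (_ ≤∞∞)           = fin≤fin p
  0≤∞-min∞ (_ ≤∞∞)           q                 = q

  InO-cong : ∀ {x y} → x ≈ y → InO x → InO y
  InO-cong x≈y = ≡.subst (fin 0ℤ ≤∞_) (v-cong x≈y)

  InO-0# : InO 0#
  InO-0# = ≡.subst (fin 0ℤ ≤∞_) (≡.sym (Equivalence.from (v-∞ 0#) refl)) (_ ≤∞∞)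

  InO-π^ : ∀ k → InO (π ^ k)
  InO-π^ k = ≡.subst (fin 0ℤ ≤∞_) (≡.sym (v-π^ k)) (fin≤fin (+≤+ z≤n))

  InO-1# : InO 1#
  InO-1# = InO-π^ 0

  InO-π : InO π
  InO-π = InO-cong (*-identityʳ π) (InO-π^ 1)

  InO-+ : ∀ {x y} → InO x → InO y → InO (x + y)
  InO-+ {x} {y} x∈O y∈O = ≤∞-trans (0≤∞-min∞ x∈O y∈O) (v-ultra x y)

  InO-* : ∀ {x y} → InO x → InO y → InO (x * y)
  InO-* {x} {y} x∈O y∈O = ≡.subst (fin 0ℤ ≤∞_) (≡.sym (v-mult x y)) (0≤∞-+∞ x∈O y∈O)

  -- v (-1) + v (-1) = v 1 = 0, which no negative integer satisfies.
  InO-[-1] : InO (- 1#)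
  InO-[-1] with v (- 1#) in eq
  ... | ∞     = _ ≤∞∞
  ... | fin n = nonneg n (begin
    fin (n ℤ.+ n)            ≡⟨ ≡.cong₂ _+∞_ eq eq ⟨
    v (- 1#) +∞ v (- 1#)     ≡⟨ v-mult (- 1#) (- 1#) ⟨
    v (- 1# * - 1#)          ≡⟨ v-cong (trans (-1*x≈-x (- 1#)) (-‿involutive 1#)) ⟩
    v 1#                     ≡⟨ v-1# ⟩
    fin 0ℤ                   ∎)
    where
      open ≡.≡-Reasoning
      nonneg : ∀ n → fin (n ℤ.+ n) ≡ fin 0ℤ → fin 0ℤ ≤∞ fin n
      nonneg (+ _) _ = fin≤fin (+≤+ z≤n)

  InO-neg : ∀ {x} → InO x → InO (- x)
  InO-neg {x} x∈O = InO-cong (-1*x≈-x x) (InO-* InO-[-1] x∈O)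

  InO-- : ∀ {x y} → InO x → InO y → InO (x - y)
  InO-- x∈O y∈O = InO-+ x∈O (InO-neg y∈O)

  _∣𝒪_ : Carrier → Carrier → Set (c ⊔ ℓ)
  t ∣𝒪 a = Σ Carrier (λ x → InO x × a ≈ t * x)

  x*y≈0⇒x≈0 : ∀ {x y} → x * y ≈ 0# → ¬ (y ≈ 0#) → x ≈ 0#
  x*y≈0⇒x≈0 {x} {y} xy≈0 y≉0 with inverse y y≉0
  ... | z , yz≈1 = begin
    x              ≈⟨ *-identityʳ x ⟨
    x * 1#         ≈⟨ *-congˡ yz≈1 ⟨
    x * (y * z)    ≈⟨ *-assoc x y z ⟨
    (x * y) * z    ≈⟨ *-congʳ xy≈0 ⟩
    0# * z         ≈⟨ zeroˡ z ⟩
    0#             ∎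
    where open Relation.Binary.Reasoning.Setoid setoid

  π^k≉b*π^[1+k] : ∀ {b} k → InO b → ¬ (π ^ k ≈ b * π ^ suc k)
  π^k≉b*π^[1+k] {b} k b∈O eq = impossible b∈O (begin
    fin (+ k)                   ≡⟨ v-π^ k ⟨
    v (π ^ k)                   ≡⟨ v-cong eq ⟩
    v (b * π ^ suc k)           ≡⟨ v-mult b (π ^ suc k) ⟩
    v b +∞ v (π ^ suc k)        ≡⟨ ≡.cong (v b +∞_) (v-π^ (suc k)) ⟩
    v b +∞ fin (+ suc k)        ∎)
    where
      open ≡.≡-Reasoning
      impossible : ∀ {x} → fin 0ℤ ≤∞ x → ¬ (fin (+ k) ≡ x +∞ fin (+ suc k))
      impossible (fin≤fin (+≤+ {n = j} _)) e =
        ℕ.<-irrefl (ℤ.+-injective (fin-injective e)) (ℕ.m≤n+m (suc k) j)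
      impossible (_ ≤∞∞) ()

module Plane {c ℓ : Level} (K : CompleteDVF c ℓ) where
  open CompleteDVF K
  open LinAlg K
  open import Algebra.Properties.Ring ring
    using (-‿+-comm; ⁻¹-anti-homo‿-; [y-z]x≈yx-zx; x[y-z]≈xy-xz; xyx⁻¹≈y; //-rightDividesˡ; -1*x≈-x)
  open import Algebra.Properties.CommutativeSemigroup +-commutativeSemigroup using (interchange)
  open import Algebra.Properties.CommutativeSemigroup *-commutativeSemigroup using (x∙yz≈y∙xz)
  open import Algebra.Solver.Ring.NaturalCoefficients.Default commutativeSemiring using (solve; _:=_; _:+_; _:*_)

  +--interchange : ∀ a b d e → (a + b) - (d + e) ≈ (a - d) + (b - e)
  +--interchange a b d e = trans (+-congˡ (sym (-‿+-comm d e))) (interchange a b (- d) (- e))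

  -‿telescope : ∀ x y z → (x - y) + (y - z) ≈ x - z
  -‿telescope x y z = trans (sym (+-assoc (x - y) y (- z))) (+-congʳ (//-rightDividesˡ y x))

  V-setoid : Setoid c ℓ
  V-setoid = ×-setoid setoid setoid

  open Setoid V-setoid public using () renaming (refl to ≈V-refl; sym to ≈V-sym; trans to ≈V-trans)

  module ≈V-Reasoning = Relation.Binary.Reasoning.Setoid V-setoid

  +V-cong : ∀ {u u' w w'} → u ≈V u' → w ≈V w' → (u +V w) ≈V (u' +V w')
  +V-cong (p , q) (p' , q') = +-cong p p' , +-cong q q'

  -V-cong : ∀ {u u' w w'} → u ≈V u' → w ≈V w' → (u -V w) ≈V (u' -V w')
  -V-cong (p , q) (p' , q') = +-cong p (-‿cong p') , +-cong q (-‿cong q')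

  +V-comm : ∀ u w → (u +V w) ≈V (w +V u)
  +V-comm _ _ = +-comm _ _ , +-comm _ _

  •-cong : ∀ {s s' u u'} → s ≈ s' → u ≈V u' → (s • u) ≈V (s' • u')
  •-cong s≈s' (p , q) = *-cong s≈s' p , *-cong s≈s' q

  •-identityˡ : ∀ u → (1# • u) ≈V u
  •-identityˡ _ = *-identityˡ _ , *-identityˡ _

  •-zeroˡ : ∀ u → (0# • u) ≈V 0V
  •-zeroˡ _ = zeroˡ _ , zeroˡ _

  •-zeroʳ : ∀ s → (s • 0V) ≈V 0V
  •-zeroʳ s = zeroʳ s , zeroʳ s

  •-assoc : ∀ s t u → ((s * t) • u) ≈V (s • (t • u))
  •-assoc s t _ = *-assoc s t _ , *-assoc s t _

  •-comm : ∀ s t u → (s • (t • u)) ≈V (t • (s • u))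
  •-comm s t _ = x∙yz≈y∙xz s t _ , x∙yz≈y∙xz s t _

  •-distribˡ-+V : ∀ s u w → (s • (u +V w)) ≈V ((s • u) +V (s • w))
  •-distribˡ-+V s _ _ = distribˡ s _ _ , distribˡ s _ _

  •-distribʳ-+ : ∀ s t u → ((s + t) • u) ≈V ((s • u) +V (t • u))
  •-distribʳ-+ s t _ = distribʳ _ s t , distribʳ _ s t

  •-distribˡ--V : ∀ s u w → (s • (u -V w)) ≈V ((s • u) -V (s • w))
  •-distribˡ--V s _ _ = x[y-z]≈xy-xz s _ _ , x[y-z]≈xy-xz s _ _

  •-distribʳ-- : ∀ s t u → ((s - t) • u) ≈V ((s • u) -V (t • u))
  •-distribʳ-- s t _ = [y-z]x≈yx-zx _ s t , [y-z]x≈yx-zx _ s t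

  •-shear : ∀ a b u w → ((a • (u +V w)) +V (b • w)) ≈V ((a • u) +V ((a + b) • w))
  •-shear a b _ _ = row _ _ , row _ _
    where
      row : ∀ x y → a * (x + y) + b * y ≈ a * x + (a + b) * y
      row = solve 4 (λ a b x y → a :* (x :+ y) :+ b :* y := a :* x :+ (a :+ b) :* y) refl a b

  -V-antisym : ∀ u w → (w -V u) ≈V ((- 1#) • (u -V w))
  -V-antisym _ _ = antisym _ _ , antisym _ _
    where
      antisym : ∀ x y → y - x ≈ - 1# * (x - y)
      antisym x y = sym (trans (-1*x≈-x (x - y)) (⁻¹-anti-homo‿- x y))

  -V-self : ∀ u → (u -V u) ≈V 0V
  -V-self _ = -‿inverseʳ _ , -‿inverseʳ _

  -V-telescope : ∀ u w z → ((u -V w) +V (w -V z)) ≈V (u -V z)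
  -V-telescope _ _ _ = -‿telescope _ _ _ , -‿telescope _ _ _

  -V-+V-cancel : ∀ u w → ((u -V w) +V w) ≈V u
  -V-+V-cancel u w = //-rightDividesˡ _ _ , //-rightDividesˡ _ _

  +V--V-cancel : ∀ u w → ((u +V w) -V u) ≈V w
  +V--V-cancel u w = xyx⁻¹≈y _ _ , xyx⁻¹≈y _ _

  +V-interchange : ∀ u u' w w' → ((u +V u') +V (w +V w')) ≈V ((u +V w) +V (u' +V w'))
  +V-interchange _ _ _ _ = interchange _ _ _ _ , interchange _ _ _ _

  +V--V-interchange : ∀ u u' w w' → ((u +V u') -V (w +V w')) ≈V ((u -V w) +V (u' -V w'))
  +V--V-interchange _ _ _ _ = +--interchange _ _ _ _ , +--interchange _ _ _ _

  ·-congˡ : ∀ {M N} u → M ≈M N → (M · u) ≈V (N · u)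
  ·-congˡ {mat _ _ _ _} {mat _ _ _ _} _ (a≈ , b≈ , c≈ , d≈) =
    +-cong (*-congʳ a≈) (*-congʳ b≈) , +-cong (*-congʳ c≈) (*-congʳ d≈)

  ·-congʳ : ∀ M {u w} → u ≈V w → (M · u) ≈V (M · w)
  ·-congʳ (mat _ _ _ _) (p , q) = +-cong (*-congˡ p) (*-congˡ q) , +-cong (*-congˡ p) (*-congˡ q)

  ·-+V : ∀ M u w → (M · (u +V w)) ≈V ((M · u) +V (M · w))
  ·-+V (mat a b c' d) _ _ = row a b , row c' d
    where
      row : ∀ a b {x y x' y'} → a * (x + x') + b * (y + y') ≈ (a * x + b * y) + (a * x' + b * y')
      row a b = trans (+-cong (distribˡ a _ _) (distribˡ b _ _)) (interchange _ _ _ _)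

  ·--V : ∀ M u w → (M · (u -V w)) ≈V ((M · u) -V (M · w))
  ·--V (mat a b c' d) _ _ = row a b , row c' d
    where
      row : ∀ a b {x y x' y'} → a * (x - x') + b * (y - y') ≈ (a * x + b * y) - (a * x' + b * y')
      row a b = trans (+-cong (x[y-z]≈xy-xz a _ _) (x[y-z]≈xy-xz b _ _)) (sym (+--interchange _ _ _ _))

  ·-• : ∀ M t u → (M · (t • u)) ≈V (t • (M · u))
  ·-• (mat a b c' d) t _ = row a b , row c' d
    where
      row : ∀ a b {x y} → a * (t * x) + b * (t * y) ≈ t * (a * x + b * y)
      row a b = trans (+-cong (x∙yz≈y∙xz a t _) (x∙yz≈y∙xz b t _)) (sym (distribˡ t _ _))

  *M-· : ∀ M N u → ((M *M N) · u) ≈V (M · (N · u))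
  *M-· (mat a b c' d) (mat a' b' c'' d') _ = row a b , row c' d
    where
      row : ∀ a b {x y} → (a * a' + b * c'') * x + (a * b' + b * d') * y ≈ a * (a' * x + b' * y) + b * (c'' * x + d' * y)
      row a b = solve 8 (λ a b a' b' c'' d' x y →
        (a :* a' :+ b :* c'') :* x :+ (a :* b' :+ b :* d') :* y := a :* (a' :* x :+ b' :* y) :+ b :* (c'' :* x :+ d' :* y))
        refl a b a' b' c'' d' _ _

  IM-· : ∀ u → (IM · u) ≈V u
  IM-· _ = trans (+-cong (*-identityˡ _) (zeroˡ _)) (+-identityʳ _) , trans (+-cong (zeroˡ _) (*-identityˡ _)) (+-identityˡ _)

module Lattices {c ℓ g ℓg : Level} (K : CompleteDVF c ℓ) (G : Group g ℓg) where
  open CompleteDVF K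
  open LinAlg K
  open Tree K G
  open ValuationRing K
  open Plane K
  open Lattice
  open ≈V-Reasoning

  infix 30 _⟨_,_⟩
  _⟨_,_⟩ : Lattice → Carrier → Carrier → V
  Λ ⟨ a , b ⟩ = (a • b₁ Λ) +V (b • b₂ Λ)

  ⟨a,0⟩≈a•b₁ : ∀ Λ a → Λ ⟨ a , 0# ⟩ ≈V (a • b₁ Λ)
  ⟨a,0⟩≈a•b₁ Λ a = ≈V-trans (+V-cong ≈V-refl (•-zeroˡ (b₂ Λ))) (+-identityʳ _ , +-identityʳ _)

  ⟨0,b⟩≈b•b₂ : ∀ Λ b → Λ ⟨ 0# , b ⟩ ≈V (b • b₂ Λ)
  ⟨0,b⟩≈b•b₂ Λ b = ≈V-trans (+V-cong (•-zeroˡ (b₁ Λ)) ≈V-refl) (+-identityˡ _ , +-identityˡ _)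

  ⟨⟩-+V : ∀ Λ a b a' b' → (Λ ⟨ a , b ⟩ +V Λ ⟨ a' , b' ⟩) ≈V Λ ⟨ a + a' , b + b' ⟩
  ⟨⟩-+V Λ a b a' b' = ≈V-trans (+V-interchange _ _ _ _)
    (+V-cong (≈V-sym (•-distribʳ-+ a a' (b₁ Λ))) (≈V-sym (•-distribʳ-+ b b' (b₂ Λ))))

  ⟨⟩--V : ∀ Λ a b a' b' → (Λ ⟨ a , b ⟩ -V Λ ⟨ a' , b' ⟩) ≈V Λ ⟨ a - a' , b - b' ⟩
  ⟨⟩--V Λ a b a' b' = ≈V-trans (+V--V-interchange _ _ _ _)
    (+V-cong (≈V-sym (•-distribʳ-- a a' (b₁ Λ))) (≈V-sym (•-distribʳ-- b b' (b₂ Λ))))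

  •-⟨⟩ : ∀ Λ s a b → (s • Λ ⟨ a , b ⟩) ≈V Λ ⟨ s * a , s * b ⟩
  •-⟨⟩ Λ s a b = ≈V-trans (•-distribˡ-+V s _ _)
    (+V-cong (≈V-sym (•-assoc s a (b₁ Λ))) (≈V-sym (•-assoc s b (b₂ Λ))))

  coordinates-unique : ∀ Λ {x y x' y'} → InO x → InO y → InO x' → InO y' →
                       Λ ⟨ x , y ⟩ ≈V Λ ⟨ x' , y' ⟩ → (x ≈ x') × (y ≈ y')
  coordinates-unique Λ {x} {y} {x'} {y'} x∈O y∈O x'∈O y'∈O eq
    with free Λ (x - x') (y - y') (InO-- x∈O x'∈O) (InO-- y∈O y'∈O) (begin
      Λ ⟨ x - x' , y - y' ⟩            ≈⟨ ⟨⟩--V Λ x y x' y' ⟨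
      Λ ⟨ x , y ⟩ -V Λ ⟨ x' , y' ⟩     ≈⟨ -V-cong eq ≈V-refl ⟩
      Λ ⟨ x' , y' ⟩ -V Λ ⟨ x' , y' ⟩   ≈⟨ -V-self _ ⟩
      0V                               ∎)
  ... | x-x'≈0 , y-y'≈0 = x∙y⁻¹≈ε⇒x≈y x x' x-x'≈0 , x∙y⁻¹≈ε⇒x≈y y y' y-y'≈0
    where open import Algebra.Properties.Ring ring using (x∙y⁻¹≈ε⇒x≈y)

  ∈L-cong : ∀ Λ {u w} → u ≈V w → u ∈L Λ → w ∈L Λ
  ∈L-cong Λ u≈w (a , b , a∈O , b∈O , u≈) = a , b , a∈O , b∈O , ≈V-trans (≈V-sym u≈w) u≈

  ⟨⟩∈L : ∀ Λ {a b} → InO a → InO b → Λ ⟨ a , b ⟩ ∈L Λ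
  ⟨⟩∈L Λ {a} {b} a∈O b∈O = a , b , a∈O , b∈O , ≈V-refl

  b₁∈L : ∀ Λ → b₁ Λ ∈L Λ
  b₁∈L Λ = ∈L-cong Λ (≈V-trans (⟨a,0⟩≈a•b₁ Λ 1#) (•-identityˡ _)) (⟨⟩∈L Λ InO-1# InO-0#)

  b₂∈L : ∀ Λ → b₂ Λ ∈L Λ
  b₂∈L Λ = ∈L-cong Λ (≈V-trans (⟨0,b⟩≈b•b₂ Λ 1#) (•-identityˡ _)) (⟨⟩∈L Λ InO-0# InO-1#)

  ∈L-+V : ∀ Λ {u w} → u ∈L Λ → w ∈L Λ → (u +V w) ∈L Λ
  ∈L-+V Λ (a , b , a∈O , b∈O , u≈) (a' , b' , a'∈O , b'∈O , w≈) =
    a + a' , b + b' , InO-+ a∈O a'∈O , InO-+ b∈O b'∈O , ≈V-trans (+V-cong u≈ w≈) (⟨⟩-+V Λ a b a' b')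

  ∈L-• : ∀ Λ {s u} → InO s → u ∈L Λ → (s • u) ∈L Λ
  ∈L-• Λ {s} s∈O (a , b , a∈O , b∈O , u≈) =
    s * a , s * b , InO-* s∈O a∈O , InO-* s∈O b∈O , ≈V-trans (•-cong refl u≈) (•-⟨⟩ Λ s a b)

  0V∈L : ∀ Λ → 0V ∈L Λ
  0V∈L Λ = ∈L-cong Λ (•-zeroˡ _) (∈L-• Λ InO-0# (b₁∈L Λ))

  •-basis⊆ : ∀ Λ Λ' s → (s • b₁ Λ) ∈L Λ' → (s • b₂ Λ) ∈L Λ' → ∀ u → u ∈L Λ → (s • u) ∈L Λ'
  •-basis⊆ Λ Λ' s sb₁∈ sb₂∈ u (a , b , a∈O , b∈O , u≈) = ∈L-cong Λ' (begin
    (a • (s • b₁ Λ)) +V (b • (s • b₂ Λ))   ≈⟨ +V-cong (•-comm a s _) (•-comm b s _) ⟩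
    (s • (a • b₁ Λ)) +V (s • (b • b₂ Λ))   ≈⟨ •-distribˡ-+V s _ _ ⟨
    s • Λ ⟨ a , b ⟩                        ≈⟨ •-cong refl u≈ ⟨
    s • u                                  ∎) (∈L-+V Λ' (∈L-• Λ' a∈O sb₁∈) (∈L-• Λ' b∈O sb₂∈))

  basis⊆ : ∀ Λ Λ' → b₁ Λ ∈L Λ' → b₂ Λ ∈L Λ' → Λ ⊆L Λ'
  basis⊆ Λ Λ' b₁∈ b₂∈ u u∈ = ∈L-cong Λ' (•-identityˡ u)
    (•-basis⊆ Λ Λ' 1# (∈L-cong Λ' (≈V-sym (•-identityˡ _)) b₁∈) (∈L-cong Λ' (≈V-sym (•-identityˡ _)) b₂∈) u u∈)

  ⊆⊇⇒Homothetic : ∀ {Λ Λ'} → Λ ⊆L Λ' → Λ' ⊆L Λ → Homothetic Λ Λ'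
  ⊆⊇⇒Homothetic {Λ} {Λ'} Λ⊆Λ' Λ'⊆Λ = 1# , 1≉0 , λ w → mk⇔
    (λ w∈Λ' → w , Λ'⊆Λ w w∈Λ' , ≈V-sym (•-identityˡ w))
    (λ { (u , u∈Λ , w≈1u) → ∈L-cong Λ' (≈V-sym (≈V-trans w≈1u (•-identityˡ u))) (Λ⊆Λ' u u∈Λ) })

  Homothetic-refl : ∀ Λ → Homothetic Λ Λ
  Homothetic-refl Λ = ⊆⊇⇒Homothetic {Λ} {Λ} (λ _ w∈ → w∈) (λ _ w∈ → w∈)

  infix 4 _≋_mod[_]_
  _≋_mod[_]_ : V → V → Carrier → Lattice → Set (c ⊔ ℓ)
  u ≋ w mod[ t ] Λ = (u -V w) ∈[ t ]L Λ

  •-inverse : ∀ {t s} → t * s ≈ 1# → ∀ u → (t • (s • u)) ≈V u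
  •-inverse {t} {s} ts≈1 u = ≈V-trans (≈V-sym (•-assoc t s u)) (≈V-trans (•-cong ts≈1 ≈V-refl) (•-identityˡ u))

  ≈V⇒≋ : ∀ {t} Λ {u w} → u ≈V w → u ≋ w mod[ t ] Λ
  ≈V⇒≋ {t} Λ {u} {w} u≈w = 0V , 0V∈L Λ , (begin
    u -V w     ≈⟨ -V-cong u≈w ≈V-refl ⟩
    w -V w     ≈⟨ -V-self w ⟩
    0V         ≈⟨ •-zeroʳ t ⟨
    t • 0V     ∎)

  ≋-setoid : Carrier → Lattice → Setoid c (c ⊔ ℓ)
  ≋-setoid t Λ = record
    { Carrier       = V
    ; _≈_           = λ u w → u ≋ w mod[ t ] Λ
    ; isEquivalence = record { refl = ≋-refl ; sym = ≋-sym ; trans = ≋-trans }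
    }
    where
      ≋-refl : ∀ {u} → u ≋ u mod[ t ] Λ
      ≋-refl = ≈V⇒≋ Λ ≈V-refl

      ≋-sym : ∀ {u w} → u ≋ w mod[ t ] Λ → w ≋ u mod[ t ] Λ
      ≋-sym {u} {w} (x , x∈Λ , u-w≈tx) = (- 1#) • x , ∈L-• Λ InO-[-1] x∈Λ , (begin
        w -V u                 ≈⟨ -V-antisym u w ⟩
        (- 1#) • (u -V w)      ≈⟨ •-cong refl u-w≈tx ⟩
        (- 1#) • (t • x)       ≈⟨ •-comm (- 1#) t x ⟩
        t • ((- 1#) • x)       ∎)

      ≋-trans : ∀ {u w z} → u ≋ w mod[ t ] Λ → w ≋ z mod[ t ] Λ → u ≋ z mod[ t ] Λ
      ≋-trans {u} {w} {z} (x , x∈Λ , u-w≈tx) (y , y∈Λ , w-z≈ty) = x +V y , ∈L-+V Λ x∈Λ y∈Λ , (begin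
        u -V z                      ≈⟨ -V-telescope u w z ⟨
        (u -V w) +V (w -V z)        ≈⟨ +V-cong u-w≈tx w-z≈ty ⟩
        (t • x) +V (t • y)          ≈⟨ •-distribˡ-+V t x y ⟨
        t • (x +V y)                ∎)

  module ≋-Reasoning t Λ = Relation.Binary.Reasoning.Setoid (≋-setoid t Λ)

  ≋-+V : ∀ {t} Λ {u u' w w'} → u ≋ w mod[ t ] Λ → u' ≋ w' mod[ t ] Λ → (u +V u') ≋ (w +V w') mod[ t ] Λ
  ≋-+V {t} Λ {u} {u'} {w} {w'} (x , x∈Λ , u-w≈tx) (y , y∈Λ , u'-w'≈ty) = x +V y , ∈L-+V Λ x∈Λ y∈Λ , (begin
    (u +V u') -V (w +V w')       ≈⟨ +V--V-interchange u u' w w' ⟩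
    (u -V w) +V (u' -V w')       ≈⟨ +V-cong u-w≈tx u'-w'≈ty ⟩
    (t • x) +V (t • y)           ≈⟨ •-distribˡ-+V t x y ⟨
    t • (x +V y)                 ∎)

  ≋-map-• : ∀ {t} Λ Λ' s → (∀ x → x ∈L Λ → (s • x) ∈L Λ') →
            ∀ {u w} → u ≋ w mod[ t ] Λ → (s • u) ≋ (s • w) mod[ t ] Λ'
  ≋-map-• {t} Λ Λ' s sΛ⊆Λ' {u} {w} (x , x∈Λ , u-w≈tx) = s • x , sΛ⊆Λ' x x∈Λ , (begin
    (s • u) -V (s • w)    ≈⟨ •-distribˡ--V s u w ⟨
    s • (u -V w)          ≈⟨ •-cong refl u-w≈tx ⟩
    s • (t • x)           ≈⟨ •-comm s t x ⟩
    t • (s • x)           ∎)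

  ≋-map-· : ∀ {t} Λ Λ' M → (∀ x → x ∈L Λ → (M · x) ∈L Λ') →
            ∀ {u w} → u ≋ w mod[ t ] Λ → (M · u) ≋ (M · w) mod[ t ] Λ'
  ≋-map-· {t} Λ Λ' M MΛ⊆Λ' {u} {w} (x , x∈Λ , u-w≈tx) = M · x , MΛ⊆Λ' x x∈Λ , (begin
    (M · u) -V (M · w)    ≈⟨ ·--V M u w ⟨
    M · (u -V w)          ≈⟨ ·-congʳ M u-w≈tx ⟩
    M · (t • x)           ≈⟨ ·-• M t x ⟩
    t • (M · x)           ∎)

  ∈[*]L⇒∈[]L : ∀ {t w} Λ Λ' s → (∀ x → x ∈L Λ → (s • x) ∈L Λ') → w ∈[ s * t ]L Λ → w ∈[ t ]L Λ'
  ∈[*]L⇒∈[]L {t} {w} Λ Λ' s sΛ⊆Λ' (x , x∈Λ , w≈stx) = s • x , sΛ⊆Λ' x x∈Λ , (begin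
    w                ≈⟨ w≈stx ⟩
    (s * t) • x      ≈⟨ •-assoc s t x ⟩
    s • (t • x)      ≈⟨ •-comm s t x ⟩
    t • (s • x)      ∎)

  ∈[1]L⇒∈L : ∀ Λ {w} → w ∈[ 1# ]L Λ → w ∈L Λ
  ∈[1]L⇒∈L Λ (x , x∈Λ , w≈1x) = ∈L-cong Λ (≈V-sym (≈V-trans w≈1x (•-identityˡ x))) x∈Λ

  ≋-coordinates : ∀ {t} Λ {a b a' b'} → InO t → InO a → InO b → InO a' → InO b' →
                  Λ ⟨ a , b ⟩ ≋ Λ ⟨ a' , b' ⟩ mod[ t ] Λ → (t ∣𝒪 (a - a')) × (t ∣𝒪 (b - b'))
  ≋-coordinates {t} Λ {a} {b} {a'} {b'} t∈O a∈O b∈O a'∈O b'∈O (x , (p , q , p∈O , q∈O , x≈) , diff≈tx)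
    with coordinates-unique Λ (InO-- a∈O a'∈O) (InO-- b∈O b'∈O) (InO-* t∈O p∈O) (InO-* t∈O q∈O) (begin
      Λ ⟨ a - a' , b - b' ⟩             ≈⟨ ⟨⟩--V Λ a b a' b' ⟨
      Λ ⟨ a , b ⟩ -V Λ ⟨ a' , b' ⟩      ≈⟨ diff≈tx ⟩
      t • x                            ≈⟨ •-cong refl x≈ ⟩
      t • Λ ⟨ p , q ⟩                  ≈⟨ •-⟨⟩ Λ t p q ⟩
      Λ ⟨ t * p , t * q ⟩              ∎)
  ... | a-a'≈tp , b-b'≈tq = (p , p∈O , a-a'≈tp) , (q , q∈O , b-b'≈tq)

  ∣𝒪⇒≋ : ∀ {t} Λ {a b w} → t ∣𝒪 (a - b) → w ∈L Λ → (a • w) ≋ (b • w) mod[ t ] Λ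
  ∣𝒪⇒≋ {t} Λ {a} {b} {w} (x , x∈O , a-b≈tx) w∈Λ = x • w , ∈L-• Λ x∈O w∈Λ , (begin
    (a • w) -V (b • w)    ≈⟨ •-distribʳ-- a b w ⟨
    (a - b) • w           ≈⟨ •-cong a-b≈tx ≈V-refl ⟩
    (t * x) • w           ≈⟨ •-assoc t x w ⟩
    t • (x • w)           ∎)

  scale₂ : Lattice → ℕ → Lattice
  scale₂ Λ k = record { b₁ = b₁ Λ ; b₂ = (π ^ k) • b₂ Λ ; free = free' ; spans = spans' }
    where
      free' : ∀ a b → InO a → InO b → ((a • b₁ Λ) +V (b • ((π ^ k) • b₂ Λ))) ≈V 0V → (a ≈ 0#) × (b ≈ 0#)
      free' a b a∈O b∈O eq with free Λ a (b * π ^ k) a∈O (InO-* b∈O (InO-π^ k))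
                                    (≈V-trans (+V-cong ≈V-refl (•-assoc b (π ^ k) (b₂ Λ))) eq)
      ... | a≈0 , bπ^k≈0 = a≈0 , x*y≈0⇒x≈0 bπ^k≈0 (π^≉0 k)

      spans' : ∀ w → Σ Carrier (λ a → Σ Carrier (λ b → w ≈V ((a • b₁ Λ) +V (b • ((π ^ k) • b₂ Λ)))))
      spans' w with spans Λ w | inverse (π ^ k) (π^≉0 k)
      ... | a , b , w≈ | s , π^ks≈1 = a , b * s , ≈V-trans w≈ (+V-cong ≈V-refl (begin
        b • b₂ Λ                      ≈⟨ •-cong b≈bsπ^k ≈V-refl ⟩
        ((b * s) * π ^ k) • b₂ Λ      ≈⟨ •-assoc (b * s) (π ^ k) (b₂ Λ) ⟩
        (b * s) • ((π ^ k) • b₂ Λ)    ∎))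
        where
          b≈bsπ^k : b ≈ (b * s) * π ^ k
          b≈bsπ^k = sym (trans (*-assoc b s _) (trans (*-congˡ (trans (*-comm s _) π^ks≈1)) (*-identityʳ b)))

  scale₂-⟨⟩ : ∀ Λ k a b → scale₂ Λ k ⟨ a , b ⟩ ≈V Λ ⟨ a , b * π ^ k ⟩
  scale₂-⟨⟩ Λ k a b = +V-cong ≈V-refl (≈V-sym (•-assoc b (π ^ k) (b₂ Λ)))

  swap : Lattice → Lattice
  swap Λ = record { b₁ = b₂ Λ ; b₂ = b₁ Λ ; free = free' ; spans = spans' }
    where
      free' : ∀ a b → InO a → InO b → ((a • b₂ Λ) +V (b • b₁ Λ)) ≈V 0V → (a ≈ 0#) × (b ≈ 0#)
      free' a b a∈O b∈O eq with free Λ b a b∈O a∈O (≈V-trans (+V-comm _ _) eq)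
      ... | b≈0 , a≈0 = a≈0 , b≈0

      spans' : ∀ w → Σ Carrier (λ a → Σ Carrier (λ b → w ≈V ((a • b₂ Λ) +V (b • b₁ Λ))))
      spans' w with spans Λ w
      ... | a , b , w≈ = b , a , ≈V-trans w≈ (+V-comm _ _)

  shear : Lattice → Lattice
  shear Λ = record { b₁ = b₁ Λ +V b₂ Λ ; b₂ = b₂ Λ ; free = free' ; spans = spans' }
    where
      free' : ∀ a b → InO a → InO b → ((a • (b₁ Λ +V b₂ Λ)) +V (b • b₂ Λ)) ≈V 0V → (a ≈ 0#) × (b ≈ 0#)
      free' a b a∈O b∈O eq with free Λ a (a + b) a∈O (InO-+ a∈O b∈O) (≈V-trans (≈V-sym (•-shear a b _ _)) eq)
      ... | a≈0 , a+b≈0 = a≈0 , trans (sym (+-identityˡ b)) (trans (+-congʳ (sym a≈0)) a+b≈0)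

      spans' : ∀ w → Σ Carrier (λ a → Σ Carrier (λ b → w ≈V ((a • (b₁ Λ +V b₂ Λ)) +V (b • b₂ Λ))))
      spans' w with spans Λ w
      ... | a , b , w≈ = a , b - a , ≈V-trans w≈ (≈V-sym (≈V-trans (•-shear a (b - a) _ _)
              (+V-cong ≈V-refl (•-cong (trans (+-comm a (b - a)) (//-rightDividesˡ a b)) ≈V-refl))))
        where open import Algebra.Properties.Ring ring using (//-rightDividesˡ)

  scale₂-0-⊆ : ∀ Λ → scale₂ Λ 0 ⊆L Λ
  scale₂-0-⊆ Λ = basis⊆ (scale₂ Λ 0) Λ (b₁∈L Λ) (∈L-• Λ InO-1# (b₂∈L Λ))

  ⊆-scale₂-0 : ∀ Λ → Λ ⊆L scale₂ Λ 0
  ⊆-scale₂-0 Λ = basis⊆ Λ Λ₀ (b₁∈L Λ₀) (∈L-cong Λ₀ (•-identityˡ (b₂ Λ)) (b₂∈L Λ₀))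
    where
      Λ₀ : Lattice
      Λ₀ = scale₂ Λ 0

  swap-⊆ : ∀ Λ → swap Λ ⊆L Λ
  swap-⊆ Λ = basis⊆ (swap Λ) Λ (b₂∈L Λ) (b₁∈L Λ)

  ⊆-swap : ∀ Λ → Λ ⊆L swap Λ
  ⊆-swap Λ = basis⊆ Λ (swap Λ) (b₂∈L (swap Λ)) (b₁∈L (swap Λ))

  shear-⊆ : ∀ Λ → shear Λ ⊆L Λ
  shear-⊆ Λ = basis⊆ (shear Λ) Λ (∈L-+V Λ (b₁∈L Λ) (b₂∈L Λ)) (b₂∈L Λ)

  ⊆-shear : ∀ Λ → Λ ⊆L shear Λ
  ⊆-shear Λ = basis⊆ Λ (shear Λ) (∈L-cong (shear Λ) b₁≈ (⟨⟩∈L (shear Λ) InO-1# InO-[-1])) (b₂∈L (shear Λ))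
    where
      b₁≈ : shear Λ ⟨ 1# , - 1# ⟩ ≈V b₁ Λ
      b₁≈ = begin
        shear Λ ⟨ 1# , - 1# ⟩     ≈⟨ •-shear 1# (- 1#) (b₁ Λ) (b₂ Λ) ⟩
        Λ ⟨ 1# , 1# - 1# ⟩        ≈⟨ +V-cong ≈V-refl (•-cong (-‿inverseʳ 1#) ≈V-refl) ⟩
        Λ ⟨ 1# , 0# ⟩             ≈⟨ ⟨a,0⟩≈a•b₁ Λ 1# ⟩
        1# • b₁ Λ                 ≈⟨ •-identityˡ (b₁ Λ) ⟩
        b₁ Λ                      ∎

  scale₂-StrictChain : ∀ Λ k → StrictChain (scale₂ Λ k) (scale₂ Λ (suc k))
  scale₂-StrictChain Λ k =
    πΛₖ⊆Λₖ₊₁ , (b₁ Λ , b₁∈L Λₖ₊₁ , b₁∉πΛₖ) , Λₖ₊₁⊆Λₖ , ((π ^ k) • b₂ Λ , b₂∈L Λₖ , π^kb₂∉Λₖ₊₁)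
    where
      Λₖ Λₖ₊₁ : Lattice
      Λₖ   = scale₂ Λ k
      Λₖ₊₁ = scale₂ Λ (suc k)

      π^[1+k]b₂≈ : ((π ^ suc k) • b₂ Λ) ≈V (π • ((π ^ k) • b₂ Λ))
      π^[1+k]b₂≈ = •-assoc π (π ^ k) (b₂ Λ)

      πΛₖ⊆Λₖ₊₁ : ∀ w → w ∈[ π ]L Λₖ → w ∈L Λₖ₊₁
      πΛₖ⊆Λₖ₊₁ w (u , u∈Λₖ , w≈πu) = ∈L-cong Λₖ₊₁ (≈V-sym w≈πu)
        (•-basis⊆ Λₖ Λₖ₊₁ π (∈L-• Λₖ₊₁ InO-π (b₁∈L Λₖ₊₁)) (∈L-cong Λₖ₊₁ π^[1+k]b₂≈ (b₂∈L Λₖ₊₁))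
                  u u∈Λₖ)

      Λₖ₊₁⊆Λₖ : Λₖ₊₁ ⊆L Λₖ
      Λₖ₊₁⊆Λₖ = basis⊆ Λₖ₊₁ Λₖ (b₁∈L Λₖ) (∈L-cong Λₖ (≈V-sym π^[1+k]b₂≈) (∈L-• Λₖ InO-π (b₂∈L Λₖ)))

      b₁∉πΛₖ : ¬ (b₁ Λ ∈[ π ]L Λₖ)
      b₁∉πΛₖ (u , (a , b , a∈O , b∈O , u≈) , b₁≈πu) =
        π^k≉b*π^[1+k] 0 a∈O (trans 1≈πa (trans (*-comm π a) (*-congˡ (sym (*-identityʳ π)))))
        where
          1≈πa : 1# ≈ π * a
          1≈πa = proj₁ (coordinates-unique Λ InO-1# InO-0# (InO-* InO-π a∈O) (InO-* (InO-* InO-π b∈O) (InO-π^ k)) (begin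
            Λ ⟨ 1# , 0# ⟩                   ≈⟨ ≈V-trans (⟨a,0⟩≈a•b₁ Λ 1#) (•-identityˡ (b₁ Λ)) ⟩
            b₁ Λ                            ≈⟨ b₁≈πu ⟩
            π • u                           ≈⟨ •-cong refl u≈ ⟩
            π • Λₖ ⟨ a , b ⟩                ≈⟨ •-⟨⟩ Λₖ π a b ⟩
            Λₖ ⟨ π * a , π * b ⟩            ≈⟨ scale₂-⟨⟩ Λ k (π * a) (π * b) ⟩
            Λ ⟨ π * a , (π * b) * π ^ k ⟩   ∎))

      π^kb₂∉Λₖ₊₁ : ¬ (((π ^ k) • b₂ Λ) ∈L Λₖ₊₁)
      π^kb₂∉Λₖ₊₁ (a , b , a∈O , b∈O , π^kb₂≈) =
        π^k≉b*π^[1+k] k b∈O (proj₂ (coordinates-unique Λ InO-0# (InO-π^ k) a∈O (InO-* b∈O (InO-π^ (suc k))) (begin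
          Λ ⟨ 0# , π ^ k ⟩            ≈⟨ ⟨0,b⟩≈b•b₂ Λ (π ^ k) ⟩
          (π ^ k) • b₂ Λ              ≈⟨ π^kb₂≈ ⟩
          Λₖ₊₁ ⟨ a , b ⟩              ≈⟨ scale₂-⟨⟩ Λ (suc k) a b ⟩
          Λ ⟨ a , b * π ^ suc k ⟩     ∎)))

  within-scale₂ : ∀ {x} Λ k n → Homothetic x (scale₂ Λ k) → Within n x (scale₂ Λ (k ℕ.+ n))
  within-scale₂ {x} Λ k zero x~Λₖ =
    ≡.subst (λ j → Within 0 x (scale₂ Λ j)) (≡.sym (ℕ.+-identityʳ k)) (here x~Λₖ)
  within-scale₂ {x} Λ k (suc n) x~Λₖ =
    ≡.subst (λ j → Within (suc n) x (scale₂ Λ j)) (≡.sym (ℕ.+-suc k n))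
      (step {z = Λₖ₊₁} (scale₂ Λ k , Λₖ₊₁ , x~Λₖ , Homothetic-refl Λₖ₊₁ , scale₂-StrictChain Λ k)
            (within-scale₂ Λ (suc k) n (Homothetic-refl Λₖ₊₁)))
    where
      Λₖ₊₁ : Lattice
      Λₖ₊₁ = scale₂ Λ (suc k)

  within-scale₂-rebased : ∀ {Λ} Λ' r → Λ ⊆L Λ' → Λ' ⊆L Λ → Within r Λ (scale₂ Λ' r)
  within-scale₂-rebased {Λ} Λ' r Λ⊆Λ' Λ'⊆Λ = within-scale₂ Λ' 0 r (⊆⊇⇒Homothetic {Λ} {scale₂ Λ' 0}
    (λ w w∈Λ → ⊆-scale₂-0 Λ' w (Λ⊆Λ' w w∈Λ)) (λ w w∈Λ'₀ → Λ'⊆Λ w (scale₂-0-⊆ Λ' w w∈Λ'₀)))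

  record Rescaling (Λ Λ' : Lattice) : Set (c ⊔ ℓ) where
    field
      t s   : Carrier
      ts≈1  : t * s ≈ 1#
      tΛ⊆Λ' : ∀ x → x ∈L Λ → (t • x) ∈L Λ'
      sΛ'⊆Λ : ∀ x → x ∈L Λ' → (s • x) ∈L Λ

  Rescaling-sym : ∀ {Λ Λ'} → Rescaling Λ Λ' → Rescaling Λ' Λ
  Rescaling-sym Λ~Λ' = record { t = s ; s = t ; ts≈1 = trans (*-comm s t) ts≈1 ; tΛ⊆Λ' = sΛ'⊆Λ ; sΛ'⊆Λ = tΛ⊆Λ' }
    where open Rescaling Λ~Λ'

  Homothetic⇒Rescaling : ∀ {Λ Λ'} → Homothetic Λ Λ' → Rescaling Λ Λ'
  Homothetic⇒Rescaling {Λ} {Λ'} (t , t≉0 , Λ'≡tΛ) with inverse t t≉0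
  ... | s , ts≈1 = record { t = t ; s = s ; ts≈1 = ts≈1 ; tΛ⊆Λ' = tΛ⊆Λ' ; sΛ'⊆Λ = sΛ'⊆Λ }
    where
      tΛ⊆Λ' : ∀ x → x ∈L Λ → (t • x) ∈L Λ'
      tΛ⊆Λ' x x∈Λ = Equivalence.from (Λ'≡tΛ (t • x)) (x , x∈Λ , ≈V-refl)

      sΛ'⊆Λ : ∀ x → x ∈L Λ' → (s • x) ∈L Λ
      sΛ'⊆Λ x x∈Λ' with Equivalence.to (Λ'≡tΛ x) x∈Λ'
      ... | u , u∈Λ , x≈tu = ∈L-cong Λ (begin
        u               ≈⟨ •-inverse (trans (*-comm s t) ts≈1) u ⟨
        s • (t • u)     ≈⟨ •-cong refl x≈tu ⟨
        s • x           ∎) u∈Λ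

module ScalarAction {c ℓ g ℓg : Level} (K : CompleteDVF c ℓ) (G : Group g ℓg) (R : Tree.Rep K G) where
  open CompleteDVF K
  open LinAlg K
  open Tree K G
  open ValuationRing K
  open Plane K
  open Lattices K G
  open Lattice
  open Rep R

  record Eigenvector (M : Mat) (u : V) (t : Carrier) (Λ : Lattice) : Set (c ⊔ ℓ) where
    field
      eigenvalue      : Carrier
      eigenvalue∈O    : InO eigenvalue
      eigencongruence : (M · u) ≋ (eigenvalue • u) mod[ t ] Λ
  open Eigenvector

  eigenvalues-agree : ∀ {t} Λ M → InO t → (e₁ : Eigenvector M (b₁ Λ) t Λ) (e₂ : Eigenvector M (b₂ Λ) t Λ)
                      (e₁₂ : Eigenvector M (b₁ Λ +V b₂ Λ) t Λ) →
                      (t ∣𝒪 (eigenvalue e₁ - eigenvalue e₁₂)) × (t ∣𝒪 (eigenvalue e₂ - eigenvalue e₁₂))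
  eigenvalues-agree {t} Λ M t∈O e₁ e₂ e₁₂ = ≋-coordinates Λ t∈O
    (eigenvalue∈O e₁) (eigenvalue∈O e₂) (eigenvalue∈O e₁₂) (eigenvalue∈O e₁₂) (begin
      Λ ⟨ a , d ⟩                       ≈⟨ ≋-+V Λ (eigencongruence e₁) (eigencongruence e₂) ⟨
      (M · b₁ Λ) +V (M · b₂ Λ)          ≈⟨ ≈V⇒≋ Λ (·-+V M (b₁ Λ) (b₂ Λ)) ⟨
      M · (b₁ Λ +V b₂ Λ)                ≈⟨ eigencongruence e₁₂ ⟩
      s • (b₁ Λ +V b₂ Λ)                ≈⟨ ≈V⇒≋ Λ (•-distribˡ-+V s (b₁ Λ) (b₂ Λ)) ⟩
      Λ ⟨ s , s ⟩                       ∎)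
    where
      a d s : Carrier
      a = eigenvalue e₁
      d = eigenvalue e₂
      s = eigenvalue e₁₂
      open ≋-Reasoning t Λ

  ρ∙· : ∀ h h' w → (ρ (h G.∙ h') · w) ≈V (ρ h · (ρ h' · w))
  ρ∙· h h' w = ≈V-trans (·-congˡ w (ρ-hom h h')) (*M-· (ρ h) (ρ h') w)

  ρε· : ∀ w → (ρ G.ε · w) ≈V w
  ρε· w = ≈V-trans (·-congˡ w ρ-ε) (IM-· w)

  record ActsByScalars (Λ : Lattice) (m : ℕ) (χ : G.Carrier → Carrier) : Set (c ⊔ ℓ ⊔ g) where
    constructor actsByScalars
    field
      congruent : ∀ h w → w ∈L Λ → (ρ h · w) ≋ (χ h • w) mod[ π ^ m ] Λ
  open ActsByScalars

  ActsByScalars-weaken : ∀ {Λ m χ} n → ActsByScalars Λ (n ℕ.+ m) χ → ActsByScalars Λ m χ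
  ActsByScalars-weaken zero    act = act
  ActsByScalars-weaken {Λ} (suc n) act = ActsByScalars-weaken n (actsByScalars
    (λ h w w∈Λ → ∈[*]L⇒∈[]L Λ Λ π (λ x → ∈L-• Λ InO-π) (congruent act h w w∈Λ)))

  ActsByScalars-rescale : ∀ {Λ Λ' m χ} → Rescaling Λ Λ' → ActsByScalars Λ m χ → ActsByScalars Λ' m χ
  ActsByScalars-rescale {Λ} {Λ'} {m} {χ} Λ~Λ' act = actsByScalars λ h w w∈Λ' → begin
    ρ h · w                  ≈⟨ ≈V⇒≋ Λ' (≈V-trans (•-cong refl (·-• (ρ h) s w)) (•-inverse ts≈1 (ρ h · w))) ⟨
    t • (ρ h · (s • w))      ≈⟨ ≋-map-• Λ Λ' t tΛ⊆Λ' (congruent act h (s • w) (sΛ'⊆Λ w w∈Λ')) ⟩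
    t • (χ h • (s • w))      ≈⟨ ≈V⇒≋ Λ' (≈V-trans (•-comm t (χ h) _) (•-cong refl (•-inverse ts≈1 w))) ⟩
    χ h • w                  ∎
    where
      open Rescaling Λ~Λ'
      open ≋-Reasoning (π ^ m) Λ'

  ActsByScalars-adjacent : ∀ {Λ Λ' m χ} → StrictChain Λ Λ' → ActsByScalars Λ (suc m) χ → ActsByScalars Λ' m χ
  ActsByScalars-adjacent {Λ} {Λ'} (πΛ⊆Λ' , _ , Λ'⊆Λ , _) act = actsByScalars λ h w w∈Λ' →
    ∈[*]L⇒∈[]L Λ Λ' π (λ x x∈Λ → πΛ⊆Λ' (π • x) (x , x∈Λ , ≈V-refl)) (congruent act h w (Λ'⊆Λ w w∈Λ'))

  ActsByScalars-within : ∀ {n x y m χ} → Within n x y → ActsByScalars x (n ℕ.+ m) χ → ActsByScalars y m χ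
  ActsByScalars-within {n} (here x~y) act =
    ActsByScalars-rescale (Homothetic⇒Rescaling x~y) (ActsByScalars-weaken n act)
  ActsByScalars-within (step (Λ₀ , Λ₁ , x~Λ₀ , z~Λ₁ , chain) rest) act =
    ActsByScalars-within rest (ActsByScalars-rescale (Rescaling-sym (Homothetic⇒Rescaling z~Λ₁))
      (ActsByScalars-adjacent {Λ₀} {Λ₁} chain (ActsByScalars-rescale (Homothetic⇒Rescaling x~Λ₀) act)))

  ActsByScalars-0⇒InX : ∀ {Λ χ} → (∀ h → InO (χ h)) → ActsByScalars Λ 0 χ → InX R Λ
  ActsByScalars-0⇒InX {Λ} χ∈O act h w w∈Λ =
    ∈L-cong Λ (-V-+V-cancel _ _) (∈L-+V Λ (∈[1]L⇒∈L Λ (congruent act h w w∈Λ)) (∈L-• Λ (χ∈O h) w∈Λ))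

  ActsByScalars-basis : ∀ {Λ m χ} →
    (∀ h → (ρ h · b₁ Λ) ≋ (χ h • b₁ Λ) mod[ π ^ m ] Λ) →
    (∀ h → (ρ h · b₂ Λ) ≋ (χ h • b₂ Λ) mod[ π ^ m ] Λ) → ActsByScalars Λ m χ
  ActsByScalars-basis {Λ} {m} {χ} on-b₁ on-b₂ = actsByScalars λ h w → λ { (a , b , a∈O , b∈O , w≈) → begin
    ρ h · w                                    ≈⟨ ≈V⇒≋ Λ (·-congʳ (ρ h) w≈) ⟩
    ρ h · Λ ⟨ a , b ⟩                          ≈⟨ ≈V⇒≋ Λ (≈V-trans (·-+V (ρ h) _ _)
                                                                  (+V-cong (·-• (ρ h) a _) (·-• (ρ h) b _))) ⟩
    (a • (ρ h · b₁ Λ)) +V (b • (ρ h · b₂ Λ))   ≈⟨ ≋-+V Λ (≋-map-• Λ Λ a (λ _ → ∈L-• Λ a∈O) (on-b₁ h))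
                                                        (≋-map-• Λ Λ b (λ _ → ∈L-• Λ b∈O) (on-b₂ h)) ⟩
    (a • (χ h • b₁ Λ)) +V (b • (χ h • b₂ Λ))   ≈⟨ ≈V⇒≋ Λ (≈V-trans (+V-cong (•-comm a (χ h) _) (•-comm b (χ h) _))
                                                                  (≈V-sym (•-distribˡ-+V (χ h) _ _))) ⟩
    χ h • Λ ⟨ a , b ⟩                          ≈⟨ ≈V⇒≋ Λ (•-cong refl w≈) ⟨
    χ h • w                                    ∎ }
    where open ≋-Reasoning (π ^ m) Λ

  ActsByScalars⇒ActsByCharacter : ∀ {Λ m χ} → InX R Λ → (∀ h → InO (χ h)) → ActsByScalars Λ m χ → ActsByCharacter R Λ m
  ActsByScalars⇒ActsByCharacter {Λ} {m} {χ} Λ-stable χ∈O act = χ , χ∈O , χ-cong , χ-hom , χ-unit , congruent act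
    where
      open ≋-Reasoning (π ^ m) Λ

      e₁ : V
      e₁ = b₁ Λ

      ρe₁≋χe₁ : ∀ h → (ρ h · e₁) ≋ (χ h • e₁) mod[ π ^ m ] Λ
      ρe₁≋χe₁ h = congruent act h e₁ (b₁∈L Λ)

      scalars-congruent : ∀ {a b} → InO a → InO b → (a • e₁) ≋ (b • e₁) mod[ π ^ m ] Λ → CongMod R m a b
      scalars-congruent {a} {b} a∈O b∈O ae₁≋be₁ = proj₁ (≋-coordinates Λ (InO-π^ m) a∈O InO-0# b∈O InO-0# (begin
        Λ ⟨ a , 0# ⟩    ≈⟨ ≈V⇒≋ Λ (⟨a,0⟩≈a•b₁ Λ a) ⟩
        a • e₁          ≈⟨ ae₁≋be₁ ⟩
        b • e₁          ≈⟨ ≈V⇒≋ Λ (⟨a,0⟩≈a•b₁ Λ b) ⟨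
        Λ ⟨ b , 0# ⟩    ∎))

      ρ∙≋χ*χ : ∀ h h' → (ρ (h G.∙ h') · e₁) ≋ ((χ h * χ h') • e₁) mod[ π ^ m ] Λ
      ρ∙≋χ*χ h h' = begin
        ρ (h G.∙ h') · e₁      ≈⟨ ≈V⇒≋ Λ (ρ∙· h h' e₁) ⟩
        ρ h · (ρ h' · e₁)      ≈⟨ ≋-map-· Λ Λ (ρ h) (Λ-stable h) (ρe₁≋χe₁ h') ⟩
        ρ h · (χ h' • e₁)      ≈⟨ ≈V⇒≋ Λ (·-• (ρ h) (χ h') e₁) ⟩
        χ h' • (ρ h · e₁)      ≈⟨ ≋-map-• Λ Λ (χ h') (λ _ → ∈L-• Λ (χ∈O h')) (ρe₁≋χe₁ h) ⟩
        χ h' • (χ h • e₁)      ≈⟨ ≈V⇒≋ Λ (≈V-trans (≈V-sym (•-assoc (χ h') (χ h) e₁))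
                                                    (•-cong (*-comm (χ h') (χ h)) ≈V-refl)) ⟩
        (χ h * χ h') • e₁      ∎

      χ-cong : ∀ h h' → h G.≈ h' → CongMod R m (χ h) (χ h')
      χ-cong h h' h≈h' = scalars-congruent (χ∈O h) (χ∈O h') (begin
        χ h • e₁       ≈⟨ ρe₁≋χe₁ h ⟨
        ρ h · e₁       ≈⟨ ≈V⇒≋ Λ (·-congˡ e₁ (ρ-cong h≈h')) ⟩
        ρ h' · e₁      ≈⟨ ρe₁≋χe₁ h' ⟩
        χ h' • e₁      ∎)

      χ-hom : ∀ h h' → CongMod R m (χ (h G.∙ h')) (χ h * χ h')
      χ-hom h h' = scalars-congruent (χ∈O (h G.∙ h')) (InO-* (χ∈O h) (χ∈O h')) (begin
        χ (h G.∙ h') • e₁     ≈⟨ ρe₁≋χe₁ (h G.∙ h') ⟨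
        ρ (h G.∙ h') · e₁     ≈⟨ ρ∙≋χ*χ h h' ⟩
        (χ h * χ h') • e₁     ∎)

      χ-unit : ∀ h → Σ Carrier (λ u → InO u × CongMod R m (χ h * u) 1#)
      χ-unit h = χ (h G.⁻¹) , χ∈O (h G.⁻¹) , scalars-congruent (InO-* (χ∈O h) (χ∈O (h G.⁻¹))) InO-1# (begin
        (χ h * χ (h G.⁻¹)) • e₁     ≈⟨ ρ∙≋χ*χ h (h G.⁻¹) ⟨
        ρ (h G.∙ h G.⁻¹) · e₁       ≈⟨ ≈V⇒≋ Λ (≈V-trans (·-congˡ e₁ (ρ-cong (G.inverseʳ h))) (ρε· e₁)) ⟩
        e₁                          ≈⟨ ≈V⇒≋ Λ (•-identityˡ e₁) ⟨
        1# • e₁                     ∎)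

  scale₂-stable⇒eigenvector : ∀ {Λ} Λ' r → Λ' ⊆L Λ → InX R (scale₂ Λ' r) → ∀ h → Eigenvector (ρ h) (b₁ Λ') (π ^ r) Λ
  scale₂-stable⇒eigenvector Λ' r Λ'⊆Λ stable h with stable h (b₁ Λ') (b₁∈L (scale₂ Λ' r))
  ... | α , β , α∈O , β∈O , ρb₁≈ = record
    { eigenvalue      = α
    ; eigenvalue∈O    = α∈O
    ; eigencongruence = β • b₂ Λ' , Λ'⊆Λ _ (∈L-• Λ' β∈O (b₂∈L Λ')) , (begin
        (ρ h · b₁ Λ') -V (α • b₁ Λ')             ≈⟨ -V-cong ρb₁≈ ≈V-refl ⟩
        scale₂ Λ' r ⟨ α , β ⟩ -V (α • b₁ Λ')     ≈⟨ +V--V-cancel _ _ ⟩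
        β • ((π ^ r) • b₂ Λ')                    ≈⟨ •-comm β (π ^ r) (b₂ Λ') ⟩
        (π ^ r) • (β • b₂ Λ')                    ∎)
    }
    where open ≈V-Reasoning

  ball-stable⇒ActsByCharacter : ∀ {Λ} r → InX R Λ → (∀ y → Within r Λ y → InX R y) → ActsByCharacter R Λ r
  ball-stable⇒ActsByCharacter {Λ} r Λ-stable ball-stable =
    ActsByScalars⇒ActsByCharacter Λ-stable (λ h → eigenvalue∈O (eig₊ h)) (ActsByScalars-basis {Λ} {r} {χ} on-b₁ on-b₂)
    where
      open ≋-Reasoning (π ^ r) Λ

      eigenvector-of : ∀ Λ' → Λ ⊆L Λ' → Λ' ⊆L Λ → ∀ h → Eigenvector (ρ h) (b₁ Λ') (π ^ r) Λ
      eigenvector-of Λ' Λ⊆Λ' Λ'⊆Λ =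
        scale₂-stable⇒eigenvector Λ' r Λ'⊆Λ (ball-stable (scale₂ Λ' r) (within-scale₂-rebased Λ' r Λ⊆Λ' Λ'⊆Λ))

      eig₁ : ∀ h → Eigenvector (ρ h) (b₁ Λ) (π ^ r) Λ
      eig₁ = eigenvector-of Λ (λ _ w∈ → w∈) (λ _ w∈ → w∈)

      eig₂ : ∀ h → Eigenvector (ρ h) (b₂ Λ) (π ^ r) Λ
      eig₂ = eigenvector-of (swap Λ) (⊆-swap Λ) (swap-⊆ Λ)

      eig₊ : ∀ h → Eigenvector (ρ h) (b₁ Λ +V b₂ Λ) (π ^ r) Λ
      eig₊ = eigenvector-of (shear Λ) (⊆-shear Λ) (shear-⊆ Λ)

      χ : G.Carrier → Carrier
      χ h = eigenvalue (eig₊ h)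

      agree : ∀ h → ((π ^ r) ∣𝒪 (eigenvalue (eig₁ h) - χ h)) × ((π ^ r) ∣𝒪 (eigenvalue (eig₂ h) - χ h))
      agree h = eigenvalues-agree Λ (ρ h) (InO-π^ r) (eig₁ h) (eig₂ h) (eig₊ h)

      on-b₁ : ∀ h → (ρ h · b₁ Λ) ≋ (χ h • b₁ Λ) mod[ π ^ r ] Λ
      on-b₁ h = begin
        ρ h · b₁ Λ                     ≈⟨ eigencongruence (eig₁ h) ⟩
        eigenvalue (eig₁ h) • b₁ Λ     ≈⟨ ∣𝒪⇒≋ Λ (proj₁ (agree h)) (b₁∈L Λ) ⟩
        χ h • b₁ Λ                     ∎

      on-b₂ : ∀ h → (ρ h · b₂ Λ) ≋ (χ h • b₂ Λ) mod[ π ^ r ] Λ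
      on-b₂ h = begin
        ρ h · b₂ Λ                     ≈⟨ eigencongruence (eig₂ h) ⟩
        eigenvalue (eig₂ h) • b₂ Λ     ≈⟨ ∣𝒪⇒≋ Λ (proj₂ (agree h)) (b₂∈L Λ) ⟩
        χ h • b₂ Λ                     ∎

  ActsByCharacter⇒ball-stable : ∀ {Λ} r → ActsByCharacter R Λ r → ∀ y → Within r Λ y → InX R y
  ActsByCharacter⇒ball-stable {Λ} r (χ , χ∈O , _ , _ , _ , congruent) y Λ~y =
    ActsByScalars-0⇒InX χ∈O (ActsByScalars-within Λ~y
      (≡.subst (λ k → ActsByScalars Λ k χ) (≡.sym (ℕ.+-identityʳ r)) (actsByScalars congruent)))

-- The hypothesis r ≥ 1 is unused: the equivalence also holds for r = 0.
lemma2p6 : ∀ {c ℓ g ℓg : Level} (K : CompleteDVF c ℓ) (G : Group g ℓg)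
    (R : Tree.Rep K G) (Λx : Tree.Lattice K G) →
    Tree.InX K G R Λx → (r : ℕ) → r ≥ 1 →
    Tree.ActsByCharacter K G R Λx r
    ⇔ (∀ y → Tree._∈B[_,_] K G y Λx r → Tree.InX K G R y)
lemma2p6 K G R Λx Λx-stable r _ =
  mk⇔ (ActsByCharacter⇒ball-stable r) (ball-stable⇒ActsByCharacter r Λx-stable)
  where open ScalarAction K G R
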